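{- Let $\phi(x)$ be an $\mathcal{L}_{BT}$-formula such that for every $\alpha\in\{\mathbf{0},\mathbf{1}\}^*$, $\mathfrak{B}\models\phi(\overline{\alpha})$ implies $B\vdash\phi(\overline{\alpha})$. Then for every $\alpha\in\{\mathbf{0},\mathbf{1}\}^*$, $\mathfrak{B}\models(\forall x\sqsubseteq\overline{\alpha})\phi(x)$ implies $B\vdash(\forall x\sqsubseteq\overline{\alpha})\phi(x)$.
   Context: Bit strings are elements of $\{\mathbf{0},\mathbf{1}\}^*$; $\varepsilon$ is the empty string. The language $\mathcal{L}_{BT}$ has constant symbols $e,0,1$, binary function symbol $\circ$ (also written as juxtaposition), and binary relation symbol $\sqsubseteq$. The structure $\mathfrak{B}$ has universe $\{\mathbf{0},\mathbf{1}\}^*$, interprets $e,0,1$ as $\varepsilon,\mathbf{0},\mathbf{1}$, $\circ$ as concatenation, and $\sqsubseteq$ as the substring relation. $(\forall x\sqsubseteq t)\phi$ abbreviates $\forall x[x\sqsubseteq t\to\phi]$. Biterals: $\overline{\varepsilon}=e$, $\overline{\alpha\mathbf{0}}=\overline{\alpha}\circ 0$, $\overline{\alpha\mathbf{1}}=\overline{\alpha}\circ 1$. The theory $B$ has the axioms: (1) $\forall x[x=ex\wedge x=xe]$; (2) $\forall xyz[(xy)z=x(yz)]$; (3) $\forall xy[x\neq y\to(x0\neq y0\wedge x1\neq y1)]$; (4) $\forall xy[x0\neq y1]$; (5) $\forall x[x\sqsubseteq e\leftrightarrow x=e]$; (6) $\forall x[x\sqsubseteq 0\leftrightarrow(x=e\vee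 x=0)]$; (7) $\forall x[x\sqsubseteq 1\leftrightarrow(x=e\vee x=1)]$; (8)–(11): for each $a,b\in\{0,1\}$, $\forall xy[x\sqsubseteq ayb\leftrightarrow(x=ayb\vee x\sqsubseteq ay\vee x\sqsubseteq yb)]$. -}

module Defs where

open import Data.Nat using (ℕ; zero; suc)
open import Data.Fin using (Fin; zero; suc; #_)
open import Data.Bool using (Bool; true; false)
open import Data.List using (List; []; _∷_; _++_; map)
open import Data.List.Membership.Propositional using (_∈_)
open import Data.Product using (Σ; ∃; _×_; _,_)
open import Data.Sum using (_⊎_)
open import Data.Empty using (⊥)
open import Relation.Binary.PropositionalEquality using (_≡_)

-- Bit strings: elements of {0,1}*, written left to right
-- (false = bit 0, true = bit 1).

BitString : Set
BitString = List Bool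

_≼_ : BitString → BitString → Set
x ≼ y = Σ BitString λ u → Σ BitString λ v → u ++ (x ++ v) ≡ y

-- Syntax of L_BT (well-scoped, de Bruijn: Fin n = free variables).

infixl 7 _∙_
data Term (n : ℕ) : Set where
  var  : Fin n → Term n
  e    : Term n
  c0   : Term n
  c1   : Term n
  _∙_  : Term n → Term n → Term n

infix  5 _≐_ _⊑_ _≠_
infix  1 _⇔_
infixr 4 _∧'_
infixr 3 _∨'_
infixr 2 _⇒_
data Fm (n : ℕ) : Set where
  ⊥'   : Fm n
  _≐_  : Term n → Term n → Fm n
  _⊑_  : Term n → Term n → Fm n
  _⇒_  : Fm n → Fm n → Fm n
  _∧'_ : Fm n → Fm n → Fm n
  _∨'_ : Fm n → Fm n → Fm n
  ∀'   : Fm (suc n) → Fm n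
  ∃'   : Fm (suc n) → Fm n

¬' : ∀ {n} → Fm n → Fm n
¬' φ = φ ⇒ ⊥'

_⇔_ : ∀ {n} → Fm n → Fm n → Fm n
φ ⇔ ψ = (φ ⇒ ψ) ∧' (ψ ⇒ φ)

_≠_ : ∀ {n} → Term n → Term n → Fm n
s ≠ t = ¬' (s ≐ t)

renT : ∀ {n m} → (Fin n → Fin m) → Term n → Term m
renT ρ (var i) = var (ρ i)
renT ρ e = e
renT ρ c0 = c0
renT ρ c1 = c1
renT ρ (s ∙ t) = renT ρ s ∙ renT ρ t

liftR : ∀ {n m} → (Fin n → Fin m) → Fin (suc n) → Fin (suc m)
liftR ρ zero = zero
liftR ρ (suc i) = suc (ρ i)

ren : ∀ {n m} → (Fin n → Fin m) → Fm n → Fm m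
ren ρ ⊥' = ⊥'
ren ρ (s ≐ t) = renT ρ s ≐ renT ρ t
ren ρ (s ⊑ t) = renT ρ s ⊑ renT ρ t
ren ρ (φ ⇒ ψ) = ren ρ φ ⇒ ren ρ ψ
ren ρ (φ ∧' ψ) = ren ρ φ ∧' ren ρ ψ
ren ρ (φ ∨' ψ) = ren ρ φ ∨' ren ρ ψ
ren ρ (∀' φ) = ∀' (ren (liftR ρ) φ)
ren ρ (∃' φ) = ∃' (ren (liftR ρ) φ)

subT : ∀ {n m} → (Fin n → Term m) → Term n → Term m
subT σ (var i) = σ i
subT σ e = e
subT σ c0 = c0
subT σ c1 = c1
subT σ (s ∙ t) = subT σ s ∙ subT σ t

liftS : ∀ {n m} → (Fin n → Term m) → Fin (suc n) → Term (suc m)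
liftS σ zero = var zero
liftS σ (suc i) = renT suc (σ i)

sub : ∀ {n m} → (Fin n → Term m) → Fm n → Fm m
sub σ ⊥' = ⊥'
sub σ (s ≐ t) = subT σ s ≐ subT σ t
sub σ (s ⊑ t) = subT σ s ⊑ subT σ t
sub σ (φ ⇒ ψ) = sub σ φ ⇒ sub σ ψ
sub σ (φ ∧' ψ) = sub σ φ ∧' sub σ ψ
sub σ (φ ∨' ψ) = sub σ φ ∨' sub σ ψ
sub σ (∀' φ) = ∀' (sub (liftS σ) φ)
sub σ (∃' φ) = ∃' (sub (liftS σ) φ)

single : ∀ {n} → Term n → Fin (suc n) → Term n
single t zero = t
single t (suc i) = var i

_[_] : ∀ {n} → Fm (suc n) → Term n → Fm n
φ [ t ] = sub (single t) φ

wk : ∀ {n} → Fm n → Fm (suc n)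
wk = ren suc

wkT : ∀ {n} → Term n → Term (suc n)
wkT = renT suc

fromClosed : ∀ {n} → Fm 0 → Fm n
fromClosed = ren (λ ())

∀⊑ : ∀ {n} → Term n → Fm (suc n) → Fm n
∀⊑ t φ = ∀' ((var zero ⊑ wkT t) ⇒ φ)

-- Biterals: overline(ε) = e, overline(α0) = overline(α) ∘ 0, overline(α1) = overline(α) ∘ 1

bitT : ∀ {n} → Bool → Term n
bitT false = c0
bitT true  = c1

biteralFrom : ∀ {n} → Term n → BitString → Term n
biteralFrom acc [] = acc
biteralFrom acc (b ∷ bs) = biteralFrom (acc ∙ bitT b) bs

biteral : ∀ {n} → BitString → Term n
biteral α = biteralFrom e α

⟦_⟧t : ∀ {n} → Term n → (Fin n → BitString) → BitString
⟦ var i ⟧t ρ = ρ i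
⟦ e ⟧t ρ = []
⟦ c0 ⟧t ρ = false ∷ []
⟦ c1 ⟧t ρ = true ∷ []
⟦ s ∙ t ⟧t ρ = ⟦ s ⟧t ρ ++ ⟦ t ⟧t ρ

extend : ∀ {n} → (Fin n → BitString) → BitString → Fin (suc n) → BitString
extend ρ a zero = a
extend ρ a (suc i) = ρ i

⟦_⟧ : ∀ {n} → Fm n → (Fin n → BitString) → Set
⟦ ⊥' ⟧ ρ = ⊥
⟦ s ≐ t ⟧ ρ = ⟦ s ⟧t ρ ≡ ⟦ t ⟧t ρ
⟦ s ⊑ t ⟧ ρ = ⟦ s ⟧t ρ ≼ ⟦ t ⟧t ρ
⟦ φ ⇒ ψ ⟧ ρ = ⟦ φ ⟧ ρ → ⟦ ψ ⟧ ρ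
⟦ φ ∧' ψ ⟧ ρ = ⟦ φ ⟧ ρ × ⟦ ψ ⟧ ρ
⟦ φ ∨' ψ ⟧ ρ = ⟦ φ ⟧ ρ ⊎ ⟦ ψ ⟧ ρ
⟦ ∀' φ ⟧ ρ = (a : BitString) → ⟦ φ ⟧ (extend ρ a)
⟦ ∃' φ ⟧ ρ = Σ BitString λ a → ⟦ φ ⟧ (extend ρ a)

𝔅⊨_ : Fm 0 → Set
𝔅⊨ ψ = ⟦ ψ ⟧ (λ ())

infix 1 _⊢[_]_
data _⊢[_]_ : ∀ {n} → List (Fm n) → (Fm 0 → Set) → Fm n → Set₁ where
  hyp   : ∀ {n T} {Γ : List (Fm n)} {φ} → φ ∈ Γ → Γ ⊢[ T ] φ
  ax    : ∀ {n T} {Γ : List (Fm n)} {ψ} → T ψ → Γ ⊢[ T ] fromClosed ψ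
  raa   : ∀ {n T} {Γ : List (Fm n)} {φ} → (¬' φ ∷ Γ) ⊢[ T ] ⊥' → Γ ⊢[ T ] φ
  ⇒I    : ∀ {n T} {Γ : List (Fm n)} {φ ψ} → (φ ∷ Γ) ⊢[ T ] ψ → Γ ⊢[ T ] φ ⇒ ψ
  ⇒E    : ∀ {n T} {Γ : List (Fm n)} {φ ψ} → Γ ⊢[ T ] φ ⇒ ψ → Γ ⊢[ T ] φ → Γ ⊢[ T ] ψ
  ∧I    : ∀ {n T} {Γ : List (Fm n)} {φ ψ} → Γ ⊢[ T ] φ → Γ ⊢[ T ] ψ → Γ ⊢[ T ] φ ∧' ψ
  ∧E₁   : ∀ {n T} {Γ : List (Fm n)} {φ ψ} → Γ ⊢[ T ] φ ∧' ψ → Γ ⊢[ T ] φ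
  ∧E₂   : ∀ {n T} {Γ : List (Fm n)} {φ ψ} → Γ ⊢[ T ] φ ∧' ψ → Γ ⊢[ T ] ψ
  ∨I₁   : ∀ {n T} {Γ : List (Fm n)} {φ ψ} → Γ ⊢[ T ] φ → Γ ⊢[ T ] φ ∨' ψ
  ∨I₂   : ∀ {n T} {Γ : List (Fm n)} {φ ψ} → Γ ⊢[ T ] ψ → Γ ⊢[ T ] φ ∨' ψ
  ∨E    : ∀ {n T} {Γ : List (Fm n)} {φ ψ χ} → Γ ⊢[ T ] φ ∨' ψ →
          (φ ∷ Γ) ⊢[ T ] χ → (ψ ∷ Γ) ⊢[ T ] χ → Γ ⊢[ T ] χ
  ∀I    : ∀ {n T} {Γ : List (Fm n)} {φ} → map wk Γ ⊢[ T ] φ → Γ ⊢[ T ] ∀' φ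
  ∀E    : ∀ {n T} {Γ : List (Fm n)} {φ} → Γ ⊢[ T ] ∀' φ → (t : Term n) → Γ ⊢[ T ] φ [ t ]
  ∃I    : ∀ {n T} {Γ : List (Fm n)} {φ} (t : Term n) → Γ ⊢[ T ] φ [ t ] → Γ ⊢[ T ] ∃' φ
  ∃E    : ∀ {n T} {Γ : List (Fm n)} {φ ψ} → Γ ⊢[ T ] ∃' φ →
          (φ ∷ map wk Γ) ⊢[ T ] wk ψ → Γ ⊢[ T ] ψ
  ≐refl : ∀ {n T} {Γ : List (Fm n)} {t} → Γ ⊢[ T ] t ≐ t
  ≐subst : ∀ {n T} {Γ : List (Fm n)} {s t} (φ : Fm (suc n)) →
          Γ ⊢[ T ] s ≐ t → Γ ⊢[ T ] φ [ s ] → Γ ⊢[ T ] φ [ t ]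

private
  x₁ : Term 1
  x₁ = var (# 0)
  x₂ y₂ : Term 2
  x₂ = var (# 1)
  y₂ = var (# 0)
  x₃ y₃ z₃ : Term 3
  x₃ = var (# 2)
  y₃ = var (# 1)
  z₃ = var (# 0)

bitC : ∀ {n} → Bool → Term n
bitC = bitT

data BAx : Fm 0 → Set where
  B1  : BAx (∀' ((x₁ ≐ e ∙ x₁) ∧' (x₁ ≐ x₁ ∙ e)))
  B2  : BAx (∀' (∀' (∀' ((x₃ ∙ y₃) ∙ z₃ ≐ x₃ ∙ (y₃ ∙ z₃)))))
  B3  : BAx (∀' (∀' (x₂ ≠ y₂ ⇒ ((x₂ ∙ c0 ≠ y₂ ∙ c0) ∧' (x₂ ∙ c1 ≠ y₂ ∙ c1)))))
  B4  : BAx (∀' (∀' (x₂ ∙ c0 ≠ y₂ ∙ c1)))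
  B5  : BAx (∀' ((x₁ ⊑ e) ⇔ (x₁ ≐ e)))
  B6  : BAx (∀' ((x₁ ⊑ c0) ⇔ ((x₁ ≐ e) ∨' (x₁ ≐ c0))))
  B7  : BAx (∀' ((x₁ ⊑ c1) ⇔ ((x₁ ≐ e) ∨' (x₁ ≐ c1))))
  B8-11 : (a b : Bool) →
    BAx (∀' (∀' ((x₂ ⊑ (bitC a ∙ y₂) ∙ bitC b) ⇔
                 ((x₂ ≐ (bitC a ∙ y₂) ∙ bitC b) ∨'
                  ((x₂ ⊑ bitC a ∙ y₂) ∨' (x₂ ⊑ y₂ ∙ bitC b))))))

B⊢_ : Fm 0 → Set₁
B⊢ ψ = [] ⊢[ BAx ] ψ

-- B proves that every x ⊑ ᾱ is one of the finitely many biterals β̄ with β a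
-- substring of α: by induction on the length of α, axiom (5) settles α = ε,
-- axioms (1), (6), (7) settle one-bit strings, and axioms (8)–(11) reduce a
-- substring of a y b to the whole string or a substring of one of the shorter
-- strings a y and y b.  For each such β the truth of the bounded formula gives
-- 𝔅 ⊨ φ(β̄), hence B ⊢ φ(β̄) by hypothesis, and replacing β̄ by x = β̄ yields φ(x).
module Submission where

open import Defs
open import Data.Nat using (zero; suc; _<_)
open import Data.Nat.Properties using (≤-refl; ≤-reflexive; +-comm)
open import Data.Nat.Induction using (<-wellFounded)
open import Data.Fin using (Fin; zero; suc)
open import Data.Bool using (true; false)
open import Data.List using (List; []; _∷_; _++_; _∷ʳ_; map; length; initLast; _∷ʳ′_)
open import Data.List.Properties using (++-assoc; ++-identityʳ; length-++)
open import Data.List.Membership.Propositional.Properties using (∈-map⁺)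
open import Data.List.Relation.Unary.Any using (here; there)
open import Data.List.Relation.Binary.Subset.Propositional using (_⊆_)
open import Data.List.Relation.Binary.Subset.Propositional.Properties using (map⁺; ∷⁺ʳ)
open import Data.Product using (_×_; _,_; proj₁; proj₂)
open import Data.Sum using (inj₁; inj₂)
open import Function using (_∘_; _on_)
open import Induction.WellFounded using (Acc; acc; WellFounded)
open import Relation.Binary.Construct.On using (wellFounded)
open import Relation.Binary.PropositionalEquality hiding ([_])
open ≡-Reasoning

≼-[] : ∀ α → [] ≼ α
≼-[] α = [] , α , refl

≼-refl : ∀ α → α ≼ α
≼-refl α = [] , [] , ++-identityʳ α

≼-++ˡ : ∀ {β γ} δ → β ≼ γ → β ≼ (δ ++ γ)
≼-++ˡ {β} δ (u , v , u++β++v≡γ) = δ ++ u , v , trans (++-assoc δ u (β ++ v)) (cong (δ ++_) u++β++v≡γ)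

≼-++ʳ : ∀ {β γ} δ → β ≼ γ → β ≼ (γ ++ δ)
≼-++ʳ {β} {γ} δ (u , v , u++β++v≡γ) = u , v ++ δ , (begin
  u ++ (β ++ (v ++ δ))        ≡⟨ cong (u ++_) (++-assoc β v δ) ⟨
  u ++ ((β ++ v) ++ δ)        ≡⟨ ++-assoc u (β ++ v) δ ⟨
  (u ++ (β ++ v)) ++ δ        ≡⟨ cong (_++ δ) u++β++v≡γ ⟩
  γ ++ δ                      ∎)

_⊏_ : BitString → BitString → Set
_⊏_ = _<_ on length

⊏-wellFounded : WellFounded _⊏_
⊏-wellFounded = wellFounded length <-wellFounded

length-∷ʳ : ∀ (α : BitString) b → length (α ∷ʳ b) ≡ suc (length α)
length-∷ʳ α b = trans (length-++ α) (+-comm (length α) 1)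

renT-as-subT : ∀ {n m} {r : Fin n → Fin m} {σ : Fin n → Term m} →
  (∀ i → var (r i) ≡ σ i) → ∀ t → renT r t ≡ subT σ t
renT-as-subT h (var i) = h i
renT-as-subT h e = refl
renT-as-subT h c0 = refl
renT-as-subT h c1 = refl
renT-as-subT h (s ∙ t) = cong₂ _∙_ (renT-as-subT h s) (renT-as-subT h t)

subT-subT : ∀ {n m k} {σ : Fin m → Term k} {τ : Fin n → Term m} {υ : Fin n → Term k} →
  (∀ i → subT σ (τ i) ≡ υ i) → ∀ t → subT σ (subT τ t) ≡ subT υ t
subT-subT h (var i) = h i
subT-subT h e = refl
subT-subT h c0 = refl
subT-subT h c1 = refl
subT-subT h (s ∙ t) = cong₂ _∙_ (subT-subT h s) (subT-subT h t)

subT-id : ∀ {n} {σ : Fin n → Term n} → (∀ i → σ i ≡ var i) → ∀ t → subT σ t ≡ t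
subT-id h (var i) = h i
subT-id h e = refl
subT-id h c0 = refl
subT-id h c1 = refl
subT-id h (s ∙ t) = cong₂ _∙_ (subT-id h s) (subT-id h t)

subT-renT : ∀ {n m k} (σ : Fin m → Term k) (r : Fin n → Fin m) t →
  subT σ (renT r t) ≡ subT (σ ∘ r) t
subT-renT σ r t = trans (cong (subT σ) (renT-as-subT (λ _ → refl) t)) (subT-subT (λ _ → refl) t)

renT-subT : ∀ {n m k} (r : Fin m → Fin k) (σ : Fin n → Term m) t →
  renT r (subT σ t) ≡ subT (renT r ∘ σ) t
renT-subT r σ t = trans (renT-as-subT (λ _ → refl) (subT σ t))
  (subT-subT (λ i → sym (renT-as-subT (λ _ → refl) (σ i))) t)

subT-single-wkT : ∀ {n} (s t : Term n) → subT (single s) (wkT t) ≡ t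
subT-single-wkT s t = trans (subT-renT (single s) suc t) (subT-id (λ _ → refl) t)

liftR-as-liftS : ∀ {n m} {r : Fin n → Fin m} {σ : Fin n → Term m} →
  (∀ i → var (r i) ≡ σ i) → ∀ i → var (liftR r i) ≡ liftS σ i
liftR-as-liftS h zero = refl
liftR-as-liftS h (suc i) = cong wkT (h i)

liftS-id : ∀ {n} {σ : Fin n → Term n} → (∀ i → σ i ≡ var i) → ∀ i → liftS σ i ≡ var i
liftS-id h zero = refl
liftS-id h (suc i) = cong wkT (h i)

subT-liftS : ∀ {n m k} {σ : Fin m → Term k} {τ : Fin n → Term m} {υ : Fin n → Term k} →
  (∀ i → subT σ (τ i) ≡ υ i) → ∀ i → subT (liftS σ) (liftS τ i) ≡ liftS υ i
subT-liftS h zero = refl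
subT-liftS {σ = σ} {τ} {υ} h (suc i) = begin
  subT (liftS σ) (wkT (τ i))  ≡⟨ subT-renT (liftS σ) suc (τ i) ⟩
  subT (wkT ∘ σ) (τ i)        ≡⟨ renT-subT suc σ (τ i) ⟨
  wkT (subT σ (τ i))          ≡⟨ cong wkT (h i) ⟩
  wkT (υ i)                   ∎

ren-as-sub : ∀ {n m} {r : Fin n → Fin m} {σ : Fin n → Term m} →
  (∀ i → var (r i) ≡ σ i) → ∀ φ → ren r φ ≡ sub σ φ
ren-as-sub h ⊥' = refl
ren-as-sub h (s ≐ t) = cong₂ _≐_ (renT-as-subT h s) (renT-as-subT h t)
ren-as-sub h (s ⊑ t) = cong₂ _⊑_ (renT-as-subT h s) (renT-as-subT h t)
ren-as-sub h (φ ⇒ ψ) = cong₂ _⇒_ (ren-as-sub h φ) (ren-as-sub h ψ)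
ren-as-sub h (φ ∧' ψ) = cong₂ _∧'_ (ren-as-sub h φ) (ren-as-sub h ψ)
ren-as-sub h (φ ∨' ψ) = cong₂ _∨'_ (ren-as-sub h φ) (ren-as-sub h ψ)
ren-as-sub h (∀' φ) = cong ∀' (ren-as-sub (liftR-as-liftS h) φ)
ren-as-sub h (∃' φ) = cong ∃' (ren-as-sub (liftR-as-liftS h) φ)

sub-sub : ∀ {n m k} {σ : Fin m → Term k} {τ : Fin n → Term m} {υ : Fin n → Term k} →
  (∀ i → subT σ (τ i) ≡ υ i) → ∀ φ → sub σ (sub τ φ) ≡ sub υ φ
sub-sub h ⊥' = refl
sub-sub h (s ≐ t) = cong₂ _≐_ (subT-subT h s) (subT-subT h t)
sub-sub h (s ⊑ t) = cong₂ _⊑_ (subT-subT h s) (subT-subT h t)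
sub-sub h (φ ⇒ ψ) = cong₂ _⇒_ (sub-sub h φ) (sub-sub h ψ)
sub-sub h (φ ∧' ψ) = cong₂ _∧'_ (sub-sub h φ) (sub-sub h ψ)
sub-sub h (φ ∨' ψ) = cong₂ _∨'_ (sub-sub h φ) (sub-sub h ψ)
sub-sub h (∀' φ) = cong ∀' (sub-sub (subT-liftS h) φ)
sub-sub h (∃' φ) = cong ∃' (sub-sub (subT-liftS h) φ)

sub-id : ∀ {n} {σ : Fin n → Term n} → (∀ i → σ i ≡ var i) → ∀ φ → sub σ φ ≡ φ
sub-id h ⊥' = refl
sub-id h (s ≐ t) = cong₂ _≐_ (subT-id h s) (subT-id h t)
sub-id h (s ⊑ t) = cong₂ _⊑_ (subT-id h s) (subT-id h t)
sub-id h (φ ⇒ ψ) = cong₂ _⇒_ (sub-id h φ) (sub-id h ψ)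
sub-id h (φ ∧' ψ) = cong₂ _∧'_ (sub-id h φ) (sub-id h ψ)
sub-id h (φ ∨' ψ) = cong₂ _∨'_ (sub-id h φ) (sub-id h ψ)
sub-id h (∀' φ) = cong ∀' (sub-id (liftS-id h) φ)
sub-id h (∃' φ) = cong ∃' (sub-id (liftS-id h) φ)

sub-liftS-wk : ∀ {n m} (σ : Fin n → Term m) ψ → sub (liftS σ) (wk ψ) ≡ wk (sub σ ψ)
sub-liftS-wk σ ψ = begin
  sub (liftS σ) (wk ψ)        ≡⟨ cong (sub (liftS σ)) (ren-as-sub (λ _ → refl) ψ) ⟩
  sub (liftS σ) (sub (var ∘ suc) ψ)
                              ≡⟨ sub-sub (λ _ → refl) ψ ⟩
  sub (wkT ∘ σ) ψ             ≡⟨ sub-sub (λ i → sym (renT-as-subT (λ _ → refl) (σ i))) ψ ⟨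
  sub (var ∘ suc) (sub σ ψ)   ≡⟨ ren-as-sub (λ _ → refl) (sub σ ψ) ⟨
  wk (sub σ ψ)                ∎

sub-liftS-single : ∀ {n m} (σ : Fin n → Term m) φ t →
  sub (liftS σ) φ [ subT σ t ] ≡ sub σ (φ [ t ])
sub-liftS-single σ φ t = trans (sub-sub single-liftS φ) (sym (sub-sub (λ _ → refl) φ))
  where single-liftS : ∀ i → subT (single (subT σ t)) (liftS σ i) ≡ subT σ (single t i)
        single-liftS zero = refl
        single-liftS (suc i) = subT-single-wkT (subT σ t) (σ i)

sub-fromClosed : ∀ {n m} (σ : Fin n → Term m) ψ → sub σ (fromClosed ψ) ≡ fromClosed ψ
sub-fromClosed σ ψ = begin
  sub σ (fromClosed ψ)        ≡⟨ cong (sub σ) (ren-as-sub {σ = λ ()} (λ ()) ψ) ⟩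
  sub σ (sub (λ ()) ψ)        ≡⟨ sub-sub {υ = λ ()} (λ ()) ψ ⟩
  sub (λ ()) ψ                ≡⟨ ren-as-sub (λ ()) ψ ⟨
  fromClosed ψ                ∎

infixr 5 _◂_
_◂_ : ∀ {k n} → Term n → (Fin k → Term n) → Fin (suc k) → Term n
(t ◂ σ) zero = t
(t ◂ σ) (suc i) = σ i

biteralFrom-++ : ∀ {n} (t : Term n) α β → biteralFrom t (α ++ β) ≡ biteralFrom (biteralFrom t α) β
biteralFrom-++ t [] β = refl
biteralFrom-++ t (b ∷ α) β = biteralFrom-++ (t ∙ bitT b) α β

biteral-∷ʳ : ∀ {n} α b → biteral {n} (α ∷ʳ b) ≡ biteral α ∙ bitT b
biteral-∷ʳ α b = biteralFrom-++ e α (b ∷ [])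

subT-bitT : ∀ {n m} (σ : Fin n → Term m) b → subT σ (bitT b) ≡ bitT b
subT-bitT σ false = refl
subT-bitT σ true = refl

subT-biteralFrom : ∀ {n m} (σ : Fin n → Term m) t α → subT σ (biteralFrom t α) ≡ biteralFrom (subT σ t) α
subT-biteralFrom σ t [] = refl
subT-biteralFrom σ t (b ∷ α) =
  trans (subT-biteralFrom σ (t ∙ bitT b) α) (cong (λ u → biteralFrom (subT σ t ∙ u) α) (subT-bitT σ b))

subT-biteral : ∀ {n m} (σ : Fin n → Term m) α → subT σ (biteral α) ≡ biteral α
subT-biteral σ = subT-biteralFrom σ e

wkT-biteral : ∀ {n} α → wkT {n} (biteral α) ≡ biteral α
wkT-biteral α = trans (renT-as-subT (λ _ → refl) (biteral α)) (subT-biteral _ α)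

weaken : ∀ {n T} {Γ Δ : List (Fm n)} {φ} → Γ ⊆ Δ → Γ ⊢[ T ] φ → Δ ⊢[ T ] φ
weaken Γ⊆Δ (hyp p) = hyp (Γ⊆Δ p)
weaken Γ⊆Δ (ax t) = ax t
weaken Γ⊆Δ (raa d) = raa (weaken (∷⁺ʳ _ Γ⊆Δ) d)
weaken Γ⊆Δ (⇒I d) = ⇒I (weaken (∷⁺ʳ _ Γ⊆Δ) d)
weaken Γ⊆Δ (⇒E d d′) = ⇒E (weaken Γ⊆Δ d) (weaken Γ⊆Δ d′)
weaken Γ⊆Δ (∧I d d′) = ∧I (weaken Γ⊆Δ d) (weaken Γ⊆Δ d′)
weaken Γ⊆Δ (∧E₁ d) = ∧E₁ (weaken Γ⊆Δ d)
weaken Γ⊆Δ (∧E₂ d) = ∧E₂ (weaken Γ⊆Δ d)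
weaken Γ⊆Δ (∨I₁ d) = ∨I₁ (weaken Γ⊆Δ d)
weaken Γ⊆Δ (∨I₂ d) = ∨I₂ (weaken Γ⊆Δ d)
weaken Γ⊆Δ (∨E d d₁ d₂) = ∨E (weaken Γ⊆Δ d) (weaken (∷⁺ʳ _ Γ⊆Δ) d₁) (weaken (∷⁺ʳ _ Γ⊆Δ) d₂)
weaken Γ⊆Δ (∀I d) = ∀I (weaken (map⁺ wk Γ⊆Δ) d)
weaken Γ⊆Δ (∀E d t) = ∀E (weaken Γ⊆Δ d) t
weaken Γ⊆Δ (∃I t d) = ∃I t (weaken Γ⊆Δ d)
weaken Γ⊆Δ (∃E d d′) = ∃E (weaken Γ⊆Δ d) (weaken (∷⁺ʳ _ (map⁺ wk Γ⊆Δ)) d′)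
weaken Γ⊆Δ ≐refl = ≐refl
weaken Γ⊆Δ (≐subst φ d d′) = ≐subst φ (weaken Γ⊆Δ d) (weaken Γ⊆Δ d′)

map-sub-liftS-wk : ∀ {n m} (σ : Fin n → Term m) Γ →
  map (sub (liftS σ)) (map wk Γ) ≡ map wk (map (sub σ) Γ)
map-sub-liftS-wk σ [] = refl
map-sub-liftS-wk σ (ψ ∷ Γ) = cong₂ _∷_ (sub-liftS-wk σ ψ) (map-sub-liftS-wk σ Γ)

⊢-sub : ∀ {n m T} {Γ : List (Fm n)} {φ} (σ : Fin n → Term m) →
  Γ ⊢[ T ] φ → map (sub σ) Γ ⊢[ T ] sub σ φ
⊢-sub σ (hyp p) = hyp (∈-map⁺ (sub σ) p)
⊢-sub σ (ax {ψ = ψ} t) = subst (_ ⊢[ _ ]_) (sym (sub-fromClosed σ ψ)) (ax t)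
⊢-sub σ (raa d) = raa (⊢-sub σ d)
⊢-sub σ (⇒I d) = ⇒I (⊢-sub σ d)
⊢-sub σ (⇒E d d′) = ⇒E (⊢-sub σ d) (⊢-sub σ d′)
⊢-sub σ (∧I d d′) = ∧I (⊢-sub σ d) (⊢-sub σ d′)
⊢-sub σ (∧E₁ d) = ∧E₁ (⊢-sub σ d)
⊢-sub σ (∧E₂ d) = ∧E₂ (⊢-sub σ d)
⊢-sub σ (∨I₁ d) = ∨I₁ (⊢-sub σ d)
⊢-sub σ (∨I₂ d) = ∨I₂ (⊢-sub σ d)
⊢-sub σ (∨E d d₁ d₂) = ∨E (⊢-sub σ d) (⊢-sub σ d₁) (⊢-sub σ d₂)
⊢-sub σ (∀I {Γ = Γ} d) = ∀I (subst (_⊢[ _ ] _) (map-sub-liftS-wk σ Γ) (⊢-sub (liftS σ) d))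
⊢-sub σ (∀E {φ = φ} d t) = subst (_ ⊢[ _ ]_) (sub-liftS-single σ φ t) (∀E (⊢-sub σ d) (subT σ t))
⊢-sub σ (∃I {φ = φ} t d) =
  ∃I (subT σ t) (subst (_ ⊢[ _ ]_) (sym (sub-liftS-single σ φ t)) (⊢-sub σ d))
⊢-sub σ (∃E {Γ = Γ} {φ = φ} {ψ = ψ} d d′) =
  ∃E (⊢-sub σ d) (subst₂ (λ Δ χ → (sub (liftS σ) φ ∷ Δ) ⊢[ _ ] χ)
                           (map-sub-liftS-wk σ Γ) (sub-liftS-wk σ ψ) (⊢-sub (liftS σ) d′))
⊢-sub σ ≐refl = ≐refl
⊢-sub σ (≐subst {s = s} {t = t} φ d d′) =
  subst (_ ⊢[ _ ]_) (sub-liftS-single σ φ t)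
    (≐subst (sub (liftS σ) φ) (⊢-sub σ d) (subst (_ ⊢[ _ ]_) (sym (sub-liftS-single σ φ s)) (⊢-sub σ d′)))

instantiate : ∀ {k n T} {Γ : List (Fm n)} {φ : Fm k} → [] ⊢[ T ] φ →
  (σ : Fin k → Term n) → Γ ⊢[ T ] sub σ φ
instantiate d σ = weaken (λ ()) (⊢-sub σ d)

module _ {n} {T : Fm 0 → Set} {Γ : List (Fm n)} where

  ≐-sym : ∀ {s t} → Γ ⊢[ T ] s ≐ t → Γ ⊢[ T ] t ≐ s
  ≐-sym {s} {t} s≐t = subst (λ u → Γ ⊢[ T ] t ≐ u) (subT-single-wkT t s)
    (≐subst (var zero ≐ wkT s) s≐t
      (subst (λ u → Γ ⊢[ T ] s ≐ u) (sym (subT-single-wkT s s)) ≐refl))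

  ≐-trans : ∀ {s t u} → Γ ⊢[ T ] s ≐ t → Γ ⊢[ T ] t ≐ u → Γ ⊢[ T ] s ≐ u
  ≐-trans {s} {t} {u} s≐t t≐u = subst (λ v → Γ ⊢[ T ] v ≐ u) (subT-single-wkT u s)
    (≐subst (wkT s ≐ var zero) t≐u
      (subst (λ v → Γ ⊢[ T ] v ≐ t) (sym (subT-single-wkT t s)) s≐t))

  ⊑-respʳ-≐ : ∀ {x s t} → Γ ⊢[ T ] s ≐ t → Γ ⊢[ T ] x ⊑ s → Γ ⊢[ T ] x ⊑ t
  ⊑-respʳ-≐ {x} {s} {t} s≐t x⊑s = subst (λ v → Γ ⊢[ T ] v ⊑ t) (subT-single-wkT t x)
    (≐subst (wkT x ⊑ var zero) s≐t
      (subst (λ v → Γ ⊢[ T ] v ⊑ s) (sym (subT-single-wkT s x)) x⊑s))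

  ∙-congʳ : ∀ {s t u} → Γ ⊢[ T ] s ≐ t → Γ ⊢[ T ] s ∙ u ≐ t ∙ u
  ∙-congʳ {s} {t} {u} s≐t =
    subst₂ (λ v w → Γ ⊢[ T ] v ∙ w ≐ t ∙ w) (subT-single-wkT t s) (subT-single-wkT t u)
      (≐subst (wkT s ∙ wkT u ≐ var zero ∙ wkT u) s≐t
        (subst₂ (λ v w → Γ ⊢[ T ] v ∙ w ≐ s ∙ w)
                (sym (subT-single-wkT s s)) (sym (subT-single-wkT s u)) ≐refl))

  ≡⇒≐ : ∀ {s t} → s ≡ t → Γ ⊢[ T ] s ≐ t
  ≡⇒≐ refl = ≐refl

  biteralFrom-cong : ∀ {s t} α → Γ ⊢[ T ] s ≐ t → Γ ⊢[ T ] biteralFrom s α ≐ biteralFrom t α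
  biteralFrom-cong [] s≐t = s≐t
  biteralFrom-cong (b ∷ α) s≐t = biteralFrom-cong α (∙-congʳ s≐t)

infix 1 _⊢_
_⊢_ : ∀ {n} → List (Fm n) → Fm n → Set₁
Γ ⊢ φ = Γ ⊢[ BAx ] φ

module _ {n} {Γ : List (Fm n)} where

  ∙-identityˡ : ∀ t → Γ ⊢ t ≐ e ∙ t
  ∙-identityˡ t = ∧E₁ (instantiate {k = 1} (∀E (ax B1) (var zero)) (λ _ → t))

  ∙-identityʳ : ∀ t → Γ ⊢ t ≐ t ∙ e
  ∙-identityʳ t = ∧E₂ (instantiate {k = 1} (∀E (ax B1) (var zero)) (λ _ → t))

  ∙-assoc : ∀ s t u → Γ ⊢ (s ∙ t) ∙ u ≐ s ∙ (t ∙ u)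
  ∙-assoc s t u =
    instantiate {k = 3} (∀E (∀E (∀E (ax B2) (var (suc (suc zero)))) (var (suc zero))) (var zero)) (u ◂ t ◂ s ◂ λ ())

  ⊑e⇒≐e : ∀ x → Γ ⊢ x ⊑ e ⇒ x ≐ e
  ⊑e⇒≐e x = ∧E₁ (instantiate {k = 1} (∀E (ax B5) (var zero)) (λ _ → x))

  ⊑bit⇒cases : ∀ a x → Γ ⊢ x ⊑ bitT a ⇒ x ≐ e ∨' x ≐ bitT a
  ⊑bit⇒cases false x = ∧E₁ (instantiate {k = 1} (∀E (ax B6) (var zero)) (λ _ → x))
  ⊑bit⇒cases true x = ∧E₁ (instantiate {k = 1} (∀E (ax B7) (var zero)) (λ _ → x))

  ⊑bit∙∙bit⇒cases : ∀ a b x y → Γ ⊢ x ⊑ (bitT a ∙ y) ∙ bitT b ⇒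
    x ≐ (bitT a ∙ y) ∙ bitT b ∨' x ⊑ bitT a ∙ y ∨' x ⊑ y ∙ bitT b
  ⊑bit∙∙bit⇒cases false false x y =
    ∧E₁ (instantiate {k = 2} (∀E (∀E (ax (B8-11 false false)) (var (suc zero))) (var zero)) (y ◂ x ◂ λ ()))
  ⊑bit∙∙bit⇒cases false true x y =
    ∧E₁ (instantiate {k = 2} (∀E (∀E (ax (B8-11 false true)) (var (suc zero))) (var zero)) (y ◂ x ◂ λ ()))
  ⊑bit∙∙bit⇒cases true false x y =
    ∧E₁ (instantiate {k = 2} (∀E (∀E (ax (B8-11 true false)) (var (suc zero))) (var zero)) (y ◂ x ◂ λ ()))
  ⊑bit∙∙bit⇒cases true true x y =
    ∧E₁ (instantiate {k = 2} (∀E (∀E (ax (B8-11 true true)) (var (suc zero))) (var zero)) (y ◂ x ◂ λ ()))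

  biteralFrom-∙ : ∀ α s t → Γ ⊢ biteralFrom (s ∙ t) α ≐ s ∙ biteralFrom t α
  biteralFrom-∙ [] s t = ≐refl
  biteralFrom-∙ (b ∷ α) s t =
    ≐-trans (biteralFrom-cong α (∙-assoc s t (bitT b))) (biteralFrom-∙ α s (t ∙ bitT b))

  biteral-∷ : ∀ a α → Γ ⊢ biteral (a ∷ α) ≐ bitT a ∙ biteral α
  biteral-∷ a α = ≐-trans (biteralFrom-cong α e∙a≐a∙e) (biteralFrom-∙ α (bitT a) e)
    where e∙a≐a∙e : Γ ⊢ e ∙ bitT a ≐ bitT a ∙ e
          e∙a≐a∙e = ≐-trans (≐-sym (∙-identityˡ (bitT a))) (∙-identityʳ (bitT a))

⊑-biteral-elim-acc : ∀ {n} {Γ : List (Fm n)} {x χ} α → Acc _⊏_ α →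
  Γ ⊢ x ⊑ biteral α → (∀ β → β ≼ α → Γ ⊢ x ≐ biteral β ⇒ χ) → Γ ⊢ χ
⊑-biteral-elim-acc [] _ x⊑ε cases = ⇒E (cases [] (≼-refl [])) (⇒E (⊑e⇒≐e _) x⊑ε)
⊑-biteral-elim-acc (a ∷ α) (acc rec) x⊑ᾱ cases with initLast α
... | [] = ∨E (⇒E (⊑bit⇒cases a _) (⊑-respʳ-≐ (≐-sym (∙-identityˡ (bitT a))) x⊑ᾱ))
  (⇒E (weaken there (cases [] (≼-[] _))) (hyp (here refl)))
  (⇒E (weaken there (cases (a ∷ []) (≼-refl _))) (≐-trans (hyp (here refl)) (∙-identityˡ (bitT a))))
... | γ ∷ʳ′ b = ∨E (⇒E (⊑bit∙∙bit⇒cases a b _ (biteral γ)) (⊑-respʳ-≐ a∙γ∙b-split x⊑ᾱ))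
  (⇒E (weaken there (cases _ (≼-refl _))) (≐-trans (hyp (here refl)) (≐-sym a∙γ∙b-split)))
  (∨E (hyp (here refl))
    (⊑-biteral-elim-acc (a ∷ γ) (rec (≤-reflexive (cong suc (sym (length-∷ʳ γ b)))))
      (⊑-respʳ-≐ (≐-sym (biteral-∷ a γ)) (hyp (here refl)))
      (λ β β≼aγ → weaken (there ∘ there) (cases β (≼-++ʳ (b ∷ []) β≼aγ))))
    (⊑-biteral-elim-acc (γ ∷ʳ b) (rec ≤-refl)
      (⊑-respʳ-≐ (≡⇒≐ (sym (biteral-∷ʳ γ b))) (hyp (here refl)))
      (λ β β≼γb → weaken (there ∘ there) (cases β (≼-++ˡ (a ∷ []) β≼γb)))))
  where
    a∙γ∙b-split : ∀ {Δ} → Δ ⊢ biteral (a ∷ γ ∷ʳ b) ≐ (bitT a ∙ biteral γ) ∙ bitT b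
    a∙γ∙b-split = ≐-trans (≡⇒≐ (biteral-∷ʳ (a ∷ γ) b)) (∙-congʳ (biteral-∷ a γ))

⊑-biteral-elim : ∀ {n} {Γ : List (Fm n)} {x χ} α →
  Γ ⊢ x ⊑ biteral α → (∀ β → β ≼ α → Γ ⊢ x ≐ biteral β ⇒ χ) → Γ ⊢ χ
⊑-biteral-elim α = ⊑-biteral-elim-acc α (⊏-wellFounded α)

biteral-instance : ∀ {Γ : List (Fm 1)} φ β → B⊢ (φ [ biteral β ]) → Γ ⊢ var zero ≐ biteral β → Γ ⊢ φ
biteral-instance {Γ} φ β ⊢φ[β] x≐β =
  subst (Γ ⊢_) χ[x]≡φ (≐subst χ (≐-sym x≐β) (subst (Γ ⊢_) φ[β]≡χ[β] (instantiate ⊢φ[β] (λ ()))))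
  where
    -- χ [ t ] is φ with t for its variable, so ≐subst in χ turns φ(β̄) into φ(x).
    χ : Fm 2
    χ = sub (λ _ → var zero) φ
    χ[x]≡φ : χ [ var zero ] ≡ φ
    χ[x]≡φ = trans (sub-sub {υ = var} (λ { zero → refl }) φ) (sub-id (λ { zero → refl }) φ)
    φ[β]≡χ[β] : sub (λ ()) (φ [ biteral β ]) ≡ χ [ biteral β ]
    φ[β]≡χ[β] = trans (sub-sub {υ = λ _ → biteral β} (λ { zero → subT-biteral _ β }) φ)
                      (sym (sub-sub (λ { zero → refl }) φ))

⟦subT⟧ : ∀ {n m} {σ : Fin n → Term m} {ρ : Fin m → BitString} {ρ′ : Fin n → BitString} →
  (∀ i → ⟦ σ i ⟧t ρ ≡ ρ′ i) → ∀ t → ⟦ subT σ t ⟧t ρ ≡ ⟦ t ⟧t ρ′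
⟦subT⟧ h (var i) = h i
⟦subT⟧ h e = refl
⟦subT⟧ h c0 = refl
⟦subT⟧ h c1 = refl
⟦subT⟧ h (s ∙ t) = cong₂ _++_ (⟦subT⟧ h s) (⟦subT⟧ h t)

⟦liftS⟧ : ∀ {n m} {σ : Fin n → Term m} {ρ : Fin m → BitString} {ρ′ : Fin n → BitString} →
  (∀ i → ⟦ σ i ⟧t ρ ≡ ρ′ i) → ∀ a i → ⟦ liftS σ i ⟧t (extend ρ a) ≡ extend ρ′ a i
⟦liftS⟧ h a zero = refl
⟦liftS⟧ {σ = σ} {ρ} {ρ′} h a (suc i) = begin
  ⟦ wkT (σ i) ⟧t (extend ρ a)               ≡⟨ cong (λ t → ⟦ t ⟧t (extend ρ a)) (renT-as-subT (λ _ → refl) (σ i)) ⟩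
  ⟦ subT (var ∘ suc) (σ i) ⟧t (extend ρ a)  ≡⟨ ⟦subT⟧ (λ _ → refl) (σ i) ⟩
  ⟦ σ i ⟧t ρ                                ≡⟨ h i ⟩
  ρ′ i                                      ∎

⟦sub⟧ : ∀ {n m} {σ : Fin n → Term m} {ρ : Fin m → BitString} {ρ′ : Fin n → BitString} →
  (∀ i → ⟦ σ i ⟧t ρ ≡ ρ′ i) → ∀ φ → (⟦ sub σ φ ⟧ ρ → ⟦ φ ⟧ ρ′) × (⟦ φ ⟧ ρ′ → ⟦ sub σ φ ⟧ ρ)
⟦sub⟧ h ⊥' = (λ z → z) , (λ z → z)
⟦sub⟧ h (s ≐ t) =
  (λ q → trans (sym (⟦subT⟧ h s)) (trans q (⟦subT⟧ h t))) ,
  (λ q → trans (⟦subT⟧ h s) (trans q (sym (⟦subT⟧ h t))))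
⟦sub⟧ h (s ⊑ t) =
  subst₂ _≼_ (⟦subT⟧ h s) (⟦subT⟧ h t) , subst₂ _≼_ (sym (⟦subT⟧ h s)) (sym (⟦subT⟧ h t))
⟦sub⟧ h (φ ⇒ ψ) =
  (λ f → proj₁ (⟦sub⟧ h ψ) ∘ f ∘ proj₂ (⟦sub⟧ h φ)) ,
  (λ f → proj₂ (⟦sub⟧ h ψ) ∘ f ∘ proj₁ (⟦sub⟧ h φ))
⟦sub⟧ h (φ ∧' ψ) =
  (λ (p , q) → proj₁ (⟦sub⟧ h φ) p , proj₁ (⟦sub⟧ h ψ) q) ,
  (λ (p , q) → proj₂ (⟦sub⟧ h φ) p , proj₂ (⟦sub⟧ h ψ) q)
⟦sub⟧ h (φ ∨' ψ) =
  (λ { (inj₁ p) → inj₁ (proj₁ (⟦sub⟧ h φ) p) ; (inj₂ q) → inj₂ (proj₁ (⟦sub⟧ h ψ) q) }) ,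
  (λ { (inj₁ p) → inj₁ (proj₂ (⟦sub⟧ h φ) p) ; (inj₂ q) → inj₂ (proj₂ (⟦sub⟧ h ψ) q) })
⟦sub⟧ h (∀' φ) =
  (λ f a → proj₁ (⟦sub⟧ (⟦liftS⟧ h a) φ) (f a)) ,
  (λ f a → proj₂ (⟦sub⟧ (⟦liftS⟧ h a) φ) (f a))
⟦sub⟧ h (∃' φ) =
  (λ (a , p) → a , proj₁ (⟦sub⟧ (⟦liftS⟧ h a) φ) p) ,
  (λ (a , p) → a , proj₂ (⟦sub⟧ (⟦liftS⟧ h a) φ) p)

⟦biteralFrom⟧ : ∀ {n} (ρ : Fin n → BitString) t α → ⟦ biteralFrom t α ⟧t ρ ≡ ⟦ t ⟧t ρ ++ α
⟦biteralFrom⟧ ρ t [] = sym (++-identityʳ _)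
⟦biteralFrom⟧ ρ t (false ∷ α) = trans (⟦biteralFrom⟧ ρ (t ∙ c0) α) (++-assoc (⟦ t ⟧t ρ) _ α)
⟦biteralFrom⟧ ρ t (true ∷ α) = trans (⟦biteralFrom⟧ ρ (t ∙ c1) α) (++-assoc (⟦ t ⟧t ρ) _ α)

⟦biteral⟧ : ∀ {n} (ρ : Fin n → BitString) α → ⟦ biteral α ⟧t ρ ≡ α
⟦biteral⟧ ρ = ⟦biteralFrom⟧ ρ e

𝔅⊨∀⊑-biteral : ∀ φ α → 𝔅⊨ ∀⊑ (biteral α) φ → ∀ β → β ≼ α → 𝔅⊨ (φ [ biteral β ])
𝔅⊨∀⊑-biteral φ α 𝔅⊨∀ β β≼α =
  proj₂ (⟦sub⟧ single-β φ) (𝔅⊨∀ β (subst (β ≼_) (sym ⟦wkT-α⟧) β≼α))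
  where
    ⟦wkT-α⟧ : ∀ {ρ : Fin 1 → BitString} → ⟦ wkT (biteral α) ⟧t ρ ≡ α
    ⟦wkT-α⟧ {ρ} = trans (cong (λ t → ⟦ t ⟧t ρ) (wkT-biteral α)) (⟦biteral⟧ ρ α)
    single-β : ∀ {ρ ρ′ : Fin 0 → BitString} i → ⟦ single (biteral β) i ⟧t ρ ≡ extend ρ′ β i
    single-β zero = ⟦biteral⟧ _ β

lemma7 : (φ : Fm 1) →
    ((α : BitString) → 𝔅⊨ (φ [ biteral α ]) → B⊢ (φ [ biteral α ])) →
    (α : BitString) → 𝔅⊨ (∀⊑ (biteral α) φ) → B⊢ (∀⊑ (biteral α) φ)
lemma7 φ sound α 𝔅⊨∀ = ∀I (⇒I (⊑-biteral-elim α x⊑ᾱ λ β β≼α →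
    ⇒I (biteral-instance φ β (sound β (𝔅⊨∀⊑-biteral φ α 𝔅⊨∀ β β≼α)) (hyp (here refl)))))
  where
    x⊑ᾱ : ((var zero ⊑ wkT (biteral α)) ∷ []) ⊢ var zero ⊑ biteral α
    x⊑ᾱ = ⊑-respʳ-≐ (≡⇒≐ (wkT-biteral α)) (hyp (here refl))
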